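{- The vertices $x_1,x_2,\dots,x_{\ell mn}$ are pairwise distinct.
   Context: Let $\ell,m,n\geq 2$ be integers, $L=\mathrm{lcm}(\ell,m,n)$ and $\lambda=\frac{n\cdot\mathrm{lcm}(\ell,m)}{L}$. Write $V(K_\ell)=\{u_1,\dots,u_\ell\}$, $V(K_m)=\{v_1,\dots,v_m\}$, $V(K_n)=\{w_1,\dots,w_n\}$, so vertices of $K_\ell\square K_m\square K_n$ are triples $(u_a,v_b,w_c)$. Let $\rho=(u_1\,u_2\,\cdots\,u_\ell)$, $\sigma=(v_1\,v_2\,\cdots\,v_m)$, $\tau=(w_1\,w_2\,\cdots\,w_n)$ be the cyclic permutations of the respective vertex sets. Define $L\times 3$ matrices $A^{(k)}=[\mathbf{c}^{(k)}\ \mathbf{d}^{(k)}\ \mathbf{e}^{(k)}]$ (columns) for $k=1,\dots,\frac{\ell mn}{L}$ as follows: row $r$ ($r=1,\dots,L$) of $A^{(1)}$ is $(\rho^{r-1}(u_1),\sigma^{r-1}(v_1),\tau^{r-1}(w_1))$; for $k>1$, $\mathbf{c}^{(k)}=\mathbf{c}^{(1)}$, and if $k\equiv 1\pmod{\lambda}$ then $\mathbf{d}^{(k)}=\sigma(\mathbf{d}^{(k-1)})$, $\mathbf{e}^{(k)}=\mathbf{e}^{(k-1)}$, while otherwise $\mathbf{d}^{(k)}=\mathbf{d}^{(k-1)}$, $\mathbf{e}^{(k)}=\tau(\mathbf{e}^{(k-1)})$ (permutations applied entrywise). Each row is regarded as a vertex of $K_\ell\square K_m\square K_n$. For $h\in\{1,\dots,\ell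 mn\}$ write $h=Lb+c$ with $c\in\{1,\dots,L\}$, and let $x_h$ be the $c$-th row of $A^{(b+1)}$. -}

module Defs where

open import Data.Nat using (ℕ; zero; suc; _+_; _*_; _∸_; NonZero; ≢-nonZero)
open import Data.Nat.Properties using (m*n≢0; *-zeroʳ)
open import Data.Nat.DivMod using (_/_; _%_; _mod_)
open import Data.Nat.Divisibility using (_∣?_)
open import Data.Nat.LCM using (lcm; gcd*lcm)
open import Data.Nat.GCD using (gcd)
open import Data.Fin using (Fin; toℕ)
open import Data.Product using (_×_; _,_)
open import Data.Nat.Base using (nonZero; ≢-nonZero⁻¹)
open import Relation.Nullary using (yes; no)
open import Relation.Binary.PropositionalEquality using (_≡_; refl; trans; sym; cong)
open import Function using (_∘_)

lcm-nonZero : ∀ a b .{{_ : NonZero a}} .{{_ : NonZero b}} → NonZero (lcm a b)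
lcm-nonZero a b = ≢-nonZero λ eq →
  ≢-nonZero⁻¹ (a * b) {{m*n≢0 a b}}
    (trans (sym (gcd*lcm a b)) (trans (cong (gcd a b *_) eq) (*-zeroʳ (gcd a b))))

iter : ∀ {A : Set} → (A → A) → ℕ → A → A
iter f zero    x = x
iter f (suc k) x = f (iter f k x)

cyc : (k : ℕ) .{{_ : NonZero k}} → Fin k → Fin k
cyc k i = suc (toℕ i) mod k

module Construction (ℓ m n : ℕ) .{{_ : NonZero ℓ}} .{{_ : NonZero m}} .{{_ : NonZero n}} where

  -- vertices of K_ℓ □ K_m □ K_n : (u_a, v_b, w_c) with 0-based indices
  Vertex : Set
  Vertex = Fin ℓ × Fin m × Fin n

  ρ : Fin ℓ → Fin ℓ
  ρ = cyc ℓ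
  σ : Fin m → Fin m
  σ = cyc m
  τ : Fin n → Fin n
  τ = cyc n

  u₁ : Fin ℓ
  u₁ = 0 mod ℓ
  v₁ : Fin m
  v₁ = 0 mod m
  w₁ : Fin n
  w₁ = 0 mod n

  L : ℕ
  L = lcm (lcm ℓ m) n

  instance
    L-nonZero : NonZero L
    L-nonZero = lcm-nonZero (lcm ℓ m) n {{lcm-nonZero ℓ m}}

  λ′ : ℕ
  λ′ = (n * lcm ℓ m) / L

  -- a matrix with columns c, d, e; rows indexed 0-based by r (row r+1)
  Matrix : Set
  Matrix = (ℕ → Fin ℓ) × (ℕ → Fin m) × (ℕ → Fin n)

  row : Matrix → ℕ → Vertex
  row (c , d , e) r = c r , d r , e r

  -- A j = A^(j+1)
  A : ℕ → Matrix
  A zero = (λ r → iter ρ r u₁) , (λ r → iter σ r v₁) , (λ r → iter τ r w₁)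
  A (suc j) with A j | λ′ ∣? suc j   -- k = j+2 ; k ≡ 1 (mod λ) iff λ ∣ k - 1
  ... | c , d , e | yes _ = c , σ ∘ d , e
  ... | c , d , e | no  _ = c , d , τ ∘ e

  -- x_h for h ≥ 1 : h = L b + c with c ∈ {1..L}, x_h = c-th row of A^(b+1)
  x : ℕ → Vertex
  x h = row (A ((h ∸ 1) / L)) ((h ∸ 1) % L)

-- Row r of the (j+1)-th matrix is, in 0-based indices, (r mod ℓ, (s + r) mod m, (t + r) mod n),
-- where s = ⌊j/λ⌋ and t = j − s count the applications of σ and τ. Since λ L = lcm(ℓ,m) n, the
-- ℓmn/L matrices are indexed by j < g λ with g = gcd(ℓ,m), so s < g. Reducing the first two
-- coordinates modulo g forces s = s', and then r ≡ r' modulo lcm(ℓ,m), hence modulo λ. The third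
-- coordinate modulo λ ∣ n gives t ≡ t', so j ≡ j' (mod λ); together with ⌊j/λ⌋ = ⌊j'/λ⌋ this is
-- j = j'. Finally r ≡ r' modulo ℓ, m and n, i.e. modulo L, so r = r'.
module Submission where

open import Defs
open import Data.Nat using (ℕ; _*_; _≤_; NonZero)
open import Relation.Binary.PropositionalEquality using (_≡_)
open import Data.Nat using (zero; suc; _+_; _∸_; _<_; ∣_-_∣; z≤n; s≤s; ≢-nonZero; ≢-nonZero⁻¹)
open import Data.Nat.Properties
  using (≤-total; m+[n∸m]≡n; m≤n⇒∣m-n∣≡n∸m; ∣-∣-comm; ∣m+n-m+o∣≡∣n-o∣; *-distribʳ-∣-∣;
         +-comm; +-suc; *-comm; *-assoc; m≤n⇒m<n∨m≡n; 0≢1+n)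
open import Data.Nat.DivMod
  using (_%_; _/_; m≡m%n+[m/n]*n; m%n<n; m%n%n≡m%n; m<n⇒m%n≡m; [m+kn]%n≡m%n; %-remove-+ʳ;
         0/n≡0; m*n/n≡m; m<n⇒m/n≡0; +-distrib-/-∣ʳ; m<n*o⇒m/o<n)
open import Data.Nat.Divisibility
  using (_∣_; _∤_; divides; divides-refl; ∣-trans; n∣m⇒m%n≡0; _∣?_)
open import Data.Nat.GCD using (gcd; gcd[m,n]≢0; gcd[m,n]∣m; gcd[m,n]∣n)
open import Data.Nat.LCM using (lcm; lcm-least; gcd*lcm)
open import Data.Fin using (Fin; toℕ)
open import Data.Fin.Properties using (toℕ-fromℕ<)
open import Data.Product using (_×_; _,_; proj₁; proj₂)
open import Data.Sum using (inj₁; inj₂)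
open import Relation.Nullary using (yes; no; contradiction)
open import Function using (_∘_)
open import Relation.Binary.PropositionalEquality
  using (refl; sym; trans; cong; cong₂; subst; module ≡-Reasoning)

gcd-nonZero : ∀ a b .{{_ : NonZero a}} → NonZero (gcd a b)
gcd-nonZero a b = ≢-nonZero (gcd[m,n]≢0 a b (inj₁ (≢-nonZero⁻¹ a)))

infix 4 _≡_mod_

_≡_mod_ : ℕ → ℕ → (k : ℕ) .{{_ : NonZero k}} → Set
_≡_mod_ a b k = a % k ≡ b % k

module _ {k : ℕ} .{{_ : NonZero k}} where

  ≡mod⇒∣∣-∣ : ∀ {a b} → a ≡ b mod k → k ∣ ∣ a - b ∣
  ≡mod⇒∣∣-∣ {a} {b} a≡b = divides ∣ a / k - b / k ∣ (begin
    ∣ a - b ∣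
      ≡⟨ cong₂ ∣_-_∣ (m≡m%n+[m/n]*n a k) (m≡m%n+[m/n]*n b k) ⟩
    ∣ a % k + a / k * k - b % k + b / k * k ∣
      ≡⟨ cong (λ c → ∣ a % k + a / k * k - c + b / k * k ∣) (sym a≡b) ⟩
    ∣ a % k + a / k * k - a % k + b / k * k ∣
      ≡⟨ ∣m+n-m+o∣≡∣n-o∣ (a % k) (a / k * k) (b / k * k) ⟩
    ∣ a / k * k - b / k * k ∣
      ≡⟨ *-distribʳ-∣-∣ k (a / k) (b / k) ⟨
    ∣ a / k - b / k ∣ * k
      ∎)
    where open ≡-Reasoning

  ≤∧∣∸⇒≡mod : ∀ {a b} → a ≤ b → k ∣ b ∸ a → b ≡ a mod k
  ≤∧∣∸⇒≡mod {a} a≤b k∣b∸a = trans (cong (_% k) (sym (m+[n∸m]≡n a≤b))) (%-remove-+ʳ a k∣b∸a)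

  ∣∣-∣⇒≡mod : ∀ {a b} → k ∣ ∣ a - b ∣ → a ≡ b mod k
  ∣∣-∣⇒≡mod {a} {b} k∣ with ≤-total a b
  ... | inj₁ a≤b = sym (≤∧∣∸⇒≡mod a≤b (subst (k ∣_) (m≤n⇒∣m-n∣≡n∸m a≤b) k∣))
  ... | inj₂ b≤a = ≤∧∣∸⇒≡mod b≤a (subst (k ∣_) (trans (∣-∣-comm a b) (m≤n⇒∣m-n∣≡n∸m b≤a)) k∣)

  +-congˡ-≡mod : ∀ c {a b} → a ≡ b mod k → c + a ≡ c + b mod k
  +-congˡ-≡mod c {a} {b} a≡b =
    ∣∣-∣⇒≡mod (subst (k ∣_) (sym (∣m+n-m+o∣≡∣n-o∣ c a b)) (≡mod⇒∣∣-∣ a≡b))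

  +-cancelˡ-≡mod : ∀ c {a b} → c + a ≡ c + b mod k → a ≡ b mod k
  +-cancelˡ-≡mod c {a} {b} c+a≡c+b =
    ∣∣-∣⇒≡mod (subst (k ∣_) (∣m+n-m+o∣≡∣n-o∣ c a b) (≡mod⇒∣∣-∣ c+a≡c+b))

  +-cancelʳ-≡mod : ∀ {a a′ b b′} → b ≡ b′ mod k → a + b ≡ a′ + b′ mod k → a ≡ a′ mod k
  +-cancelʳ-≡mod {a} {a′} {b} {b′} b≡b′ a+b≡a′+b′ = +-cancelˡ-≡mod b′ (begin
    (b′ + a) % k  ≡⟨ cong (_% k) (+-comm b′ a) ⟩
    (a + b′) % k  ≡⟨ +-congˡ-≡mod a b≡b′ ⟨
    (a + b) % k   ≡⟨ a+b≡a′+b′ ⟩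
    (a′ + b′) % k ≡⟨ cong (_% k) (+-comm a′ b′) ⟩
    (b′ + a′) % k ∎)
    where open ≡-Reasoning

  ≡mod⇒≡ : ∀ {a b} → a < k → b < k → a ≡ b mod k → a ≡ b
  ≡mod⇒≡ a<k b<k a≡b = trans (sym (m<n⇒m%n≡m a<k)) (trans a≡b (m<n⇒m%n≡m b<k))

  /-%-injective : ∀ {a b} → a / k ≡ b / k → a ≡ b mod k → a ≡ b
  /-%-injective {a} {b} a/k≡b/k a≡b = begin
    a                  ≡⟨ m≡m%n+[m/n]*n a k ⟩
    a % k + a / k * k  ≡⟨ cong₂ (λ r q → r + q * k) a≡b a/k≡b/k ⟩
    b % k + b / k * k  ≡⟨ m≡m%n+[m/n]*n b k ⟨
    b                  ∎
    where open ≡-Reasoning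

≡mod-∣ : ∀ {d k a b} .{{_ : NonZero d}} .{{_ : NonZero k}} → d ∣ k → a ≡ b mod k → a ≡ b mod d
≡mod-∣ d∣k a≡b = ∣∣-∣⇒≡mod (∣-trans d∣k (≡mod⇒∣∣-∣ a≡b))

≡mod-lcm : ∀ {p q a b} .{{_ : NonZero p}} .{{_ : NonZero q}} .{{_ : NonZero (lcm p q)}} →
  a ≡ b mod p → a ≡ b mod q → a ≡ b mod lcm p q
≡mod-lcm a≡b a≡b′ = ∣∣-∣⇒≡mod (lcm-least (≡mod⇒∣∣-∣ a≡b) (≡mod⇒∣∣-∣ a≡b′))

≡mod-shift-injective : ∀ {p q s s′ r r′} .{{_ : NonZero p}} .{{_ : NonZero q}}
  .{{_ : NonZero (gcd p q)}} .{{_ : NonZero (lcm p q)}} →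
  s < gcd p q → s′ < gcd p q → r ≡ r′ mod p → s + r ≡ s′ + r′ mod q →
  s ≡ s′ × (r ≡ r′ mod lcm p q)
≡mod-shift-injective {p} {q} {s} {s′} {r} {r′} s<g s′<g r≡r′ s+r≡s′+r′ = s≡s′ , r≡r′[lcm]
  where
  s≡s′ : s ≡ s′
  s≡s′ = ≡mod⇒≡ s<g s′<g
    (+-cancelʳ-≡mod (≡mod-∣ (gcd[m,n]∣m p q) r≡r′) (≡mod-∣ (gcd[m,n]∣n p q) s+r≡s′+r′))
  r≡r′[lcm] : r ≡ r′ mod lcm p q
  r≡r′[lcm] = ≡mod-lcm r≡r′
    (+-cancelˡ-≡mod s (subst (λ s″ → s + r ≡ s″ + r′ mod q) (sym s≡s′) s+r≡s′+r′))

module _ {d : ℕ} .{{_ : NonZero d}} where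

  private
    suc≡ : ∀ j → suc j ≡ suc (j % d) + j / d * d
    suc≡ j = cong suc (m≡m%n+[m/n]*n j d)

    suc≡[1+q]*d : ∀ j → suc (j % d) ≡ d → suc j ≡ suc (j / d) * d
    suc≡[1+q]*d j 1+r≡d = trans (suc≡ j) (cong (_+ j / d * d) 1+r≡d)

  suc-/-∣ : ∀ j → d ∣ suc j → suc j / d ≡ suc (j / d)
  suc-/-∣ j d∣ with m≤n⇒m<n∨m≡n (m%n<n j d)
  ... | inj₁ 1+r<d = contradiction (begin
      0                                ≡⟨ n∣m⇒m%n≡0 (suc j) d d∣ ⟨
      suc j % d                        ≡⟨ cong (_% d) (suc≡ j) ⟩
      (suc (j % d) + j / d * d) % d    ≡⟨ [m+kn]%n≡m%n (suc (j % d)) (j / d) d ⟩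
      suc (j % d) % d                  ≡⟨ m<n⇒m%n≡m 1+r<d ⟩
      suc (j % d)                      ∎) 0≢1+n
    where open ≡-Reasoning
  ... | inj₂ 1+r≡d = trans (cong (_/ d) (suc≡[1+q]*d j 1+r≡d)) (m*n/n≡m (suc (j / d)) d)

  suc-/-∤ : ∀ j → d ∤ suc j → suc j / d ≡ j / d
  suc-/-∤ j d∤ with m≤n⇒m<n∨m≡n (m%n<n j d)
  ... | inj₁ 1+r<d = begin
      suc j / d                        ≡⟨ cong (_/ d) (suc≡ j) ⟩
      (suc (j % d) + j / d * d) / d    ≡⟨ +-distrib-/-∣ʳ (suc (j % d)) (divides-refl (j / d)) ⟩
      suc (j % d) / d + j / d * d / d  ≡⟨ cong₂ _+_ (m<n⇒m/n≡0 1+r<d) (m*n/n≡m (j / d) d) ⟩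
      j / d                            ∎
    where open ≡-Reasoning
  ... | inj₂ 1+r≡d = contradiction (divides (suc (j / d)) (suc≡[1+q]*d j 1+r≡d)) d∤

module _ {k : ℕ} .{{_ : NonZero k}} where

  toℕ-cyc : ∀ {a} (i : Fin k) → toℕ i ≡ a % k → toℕ (cyc k i) ≡ suc a % k
  toℕ-cyc {a} i i≡a = begin
    toℕ (cyc k i)    ≡⟨ toℕ-fromℕ< (m%n<n (suc (toℕ i)) k) ⟩
    suc (toℕ i) % k  ≡⟨ cong (λ c → suc c % k) i≡a ⟩
    suc (a % k) % k  ≡⟨ +-congˡ-≡mod 1 (m%n%n≡m%n a k) ⟩
    suc a % k        ∎
    where open ≡-Reasoning

  toℕ-iter-cyc : ∀ r (i : Fin k) → toℕ i ≡ 0 % k → toℕ (iter (cyc k) r i) ≡ r % k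
  toℕ-iter-cyc zero    i i≡0 = i≡0
  toℕ-iter-cyc (suc r) i i≡0 = toℕ-cyc (iter (cyc k) r i) (toℕ-iter-cyc r i i≡0)

module Rows (ℓ m n : ℕ) .{{_ : NonZero ℓ}} .{{_ : NonZero m}} .{{_ : NonZero n}} where
  open Construction ℓ m n

  σCount : ℕ → ℕ
  σCount zero = 0
  σCount (suc j) with λ′ ∣? suc j
  ... | yes _ = suc (σCount j)
  ... | no  _ = σCount j

  τCount : ℕ → ℕ
  τCount zero = 0
  τCount (suc j) with λ′ ∣? suc j
  ... | yes _ = τCount j
  ... | no  _ = suc (τCount j)

  σCount+τCount : ∀ j → σCount j + τCount j ≡ j
  σCount+τCount zero = refl
  σCount+τCount (suc j) with λ′ ∣? suc j
  ... | yes _ = cong suc (σCount+τCount j)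
  ... | no  _ = trans (+-suc (σCount j) (τCount j)) (cong suc (σCount+τCount j))

  Shifted : Matrix → ℕ → ℕ → Set
  Shifted (c , d , e) s t =
    ∀ r → toℕ (c r) ≡ r % ℓ × toℕ (d r) ≡ (s + r) % m × toℕ (e r) ≡ (t + r) % n

  A-shifted : ∀ j → Shifted (A j) (σCount j) (τCount j)
  A-shifted zero r =
      toℕ-iter-cyc r u₁ (toℕ-fromℕ< _)
    , toℕ-iter-cyc r v₁ (toℕ-fromℕ< _)
    , toℕ-iter-cyc r w₁ (toℕ-fromℕ< _)
  A-shifted (suc j) with A j | A-shifted j | λ′ ∣? suc j
  ... | c , d , e | shifted | yes _ = λ r →
    let (c≡ , d≡ , e≡) = shifted r in c≡ , toℕ-cyc (d r) d≡ , e≡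
  ... | c , d , e | shifted | no  _ = λ r →
    let (c≡ , d≡ , e≡) = shifted r in c≡ , d≡ , toℕ-cyc (e r) e≡

  M : ℕ
  M = lcm ℓ m

  g : ℕ
  g = gcd ℓ m

  instance
    M-nonZero : NonZero M
    M-nonZero = lcm-nonZero ℓ m

    g-nonZero : NonZero g
    g-nonZero = gcd-nonZero ℓ m

  λ′≡gcd : λ′ ≡ gcd M n
  λ′≡gcd = begin
    n * M / L        ≡⟨ cong (_/ L) (*-comm n M) ⟩
    M * n / L        ≡⟨ cong (_/ L) (gcd*lcm M n) ⟨
    gcd M n * L / L  ≡⟨ m*n/n≡m (gcd M n) L ⟩
    gcd M n          ∎
    where open ≡-Reasoning

  instance
    λ′-nonZero : NonZero λ′
    λ′-nonZero = subst NonZero (sym λ′≡gcd) (gcd-nonZero M n)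

  λ′∣M : λ′ ∣ M
  λ′∣M = subst (_∣ M) (sym λ′≡gcd) (gcd[m,n]∣m M n)

  λ′∣n : λ′ ∣ n
  λ′∣n = subst (_∣ n) (sym λ′≡gcd) (gcd[m,n]∣n M n)

  matrixCount : g * λ′ * L ≡ ℓ * m * n
  matrixCount = begin
    g * λ′ * L         ≡⟨ *-assoc g λ′ L ⟩
    g * (λ′ * L)       ≡⟨ cong (λ c → g * (c * L)) λ′≡gcd ⟩
    g * (gcd M n * L)  ≡⟨ cong (g *_) (gcd*lcm M n) ⟩
    g * (M * n)        ≡⟨ *-assoc g M n ⟨
    g * M * n          ≡⟨ cong (_* n) (gcd*lcm ℓ m) ⟩
    ℓ * m * n          ∎
    where open ≡-Reasoning

  σCount≡/ : ∀ j → σCount j ≡ j / λ′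
  σCount≡/ zero = sym (0/n≡0 λ′)
  σCount≡/ (suc j) with λ′ ∣? suc j
  ... | yes λ′∣ = trans (cong suc (σCount≡/ j)) (sym (suc-/-∣ j λ′∣))
  ... | no  λ′∤ = trans (σCount≡/ j) (sym (suc-/-∤ j λ′∤))

  row-≡mod : ∀ {j j′ r r′} → row (A j) r ≡ row (A j′) r′ →
    (r ≡ r′ mod ℓ) × (σCount j + r ≡ σCount j′ + r′ mod m) × (τCount j + r ≡ τCount j′ + r′ mod n)
  row-≡mod {j} {j′} {r} {r′} same with A-shifted j r | A-shifted j′ r′
  ... | c≡ , d≡ , e≡ | c′≡ , d′≡ , e′≡ =
      trans (sym c≡) (trans (cong (toℕ ∘ proj₁) same) c′≡)
    , trans (sym d≡) (trans (cong (toℕ ∘ proj₁ ∘ proj₂) same) d′≡)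
    , trans (sym e≡) (trans (cong (toℕ ∘ proj₂ ∘ proj₂) same) e′≡)

  rows-injective : ∀ {j j′ r r′} → j < g * λ′ → j′ < g * λ′ → r < L → r′ < L →
    row (A j) r ≡ row (A j′) r′ → j ≡ j′ × r ≡ r′
  rows-injective {j} {j′} {r} {r′} j< j′< r<L r′<L same with row-≡mod {j} {j′} same
  ... | r≡r′[ℓ] , σr≡σ′r′[m] , τr≡τ′r′[n] = j≡j′ , r≡r′
    where
    σCount<g : ∀ {i} → i < g * λ′ → σCount i < g
    σCount<g {i} i< = subst (_< g) (sym (σCount≡/ i)) (m<n*o⇒m/o<n i<)

    σ≡σ′∧r≡r′[M] : σCount j ≡ σCount j′ × (r ≡ r′ mod M)
    σ≡σ′∧r≡r′[M] = ≡mod-shift-injective (σCount<g j<) (σCount<g j′<) r≡r′[ℓ] σr≡σ′r′[m]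

    σ≡σ′ : σCount j ≡ σCount j′
    σ≡σ′ = proj₁ σ≡σ′∧r≡r′[M]

    r≡r′[M] : r ≡ r′ mod M
    r≡r′[M] = proj₂ σ≡σ′∧r≡r′[M]

    τ≡τ′[λ′] : τCount j ≡ τCount j′ mod λ′
    τ≡τ′[λ′] = +-cancelʳ-≡mod {k = λ′} (≡mod-∣ λ′∣M r≡r′[M]) (≡mod-∣ λ′∣n τr≡τ′r′[n])

    j≡j′[λ′] : j ≡ j′ mod λ′
    j≡j′[λ′] = begin
      j % λ′                          ≡⟨ cong (_% λ′) (σCount+τCount j) ⟨
      (σCount j + τCount j) % λ′      ≡⟨ +-congˡ-≡mod {k = λ′} (σCount j) τ≡τ′[λ′] ⟩
      (σCount j + τCount j′) % λ′     ≡⟨ cong (λ s → (s + τCount j′) % λ′) σ≡σ′ ⟩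
      (σCount j′ + τCount j′) % λ′    ≡⟨ cong (_% λ′) (σCount+τCount j′) ⟩
      j′ % λ′                         ∎
      where open ≡-Reasoning

    j≡j′ : j ≡ j′
    j≡j′ = /-%-injective {k = λ′} (trans (sym (σCount≡/ j)) (trans σ≡σ′ (σCount≡/ j′))) j≡j′[λ′]

    r≡r′[n] : r ≡ r′ mod n
    r≡r′[n] = +-cancelˡ-≡mod (τCount j)
      (subst (λ i → τCount j + r ≡ τCount i + r′ mod n) (sym j≡j′) τr≡τ′r′[n])

    r≡r′ : r ≡ r′
    r≡r′ = ≡mod⇒≡ r<L r′<L (≡mod-lcm {p = M} {q = n} r≡r′[M] r≡r′[n])

  x-suc-injective : ∀ {a a′} → a < ℓ * m * n → a′ < ℓ * m * n → x (suc a) ≡ x (suc a′) → a ≡ a′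
  x-suc-injective {a} {a′} a< a′< same = /-%-injective {k = L} (proj₁ a≡a′) (proj₂ a≡a′)
    where
    quotient< : ∀ {b} → b < ℓ * m * n → b / L < g * λ′
    quotient< {b} b< = m<n*o⇒m/o<n (subst (b <_) (sym matrixCount) b<)

    a≡a′ : a / L ≡ a′ / L × a % L ≡ a′ % L
    a≡a′ = rows-injective (quotient< a<) (quotient< a′<) (m%n<n a L) (m%n<n a′ L) same

-- Injectivity holds for all nonzero ℓ, m, n.
mainTheorem9 : (ℓ m n : ℕ) .{{_ : NonZero ℓ}} .{{_ : NonZero m}} .{{_ : NonZero n}} →
    2 ≤ ℓ → 2 ≤ m → 2 ≤ n →
    (h h′ : ℕ) → 1 ≤ h → h ≤ ℓ * m * n → 1 ≤ h′ → h′ ≤ ℓ * m * n →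
    Construction.x ℓ m n h ≡ Construction.x ℓ m n h′ → h ≡ h′
mainTheorem9 ℓ m n _ _ _ (suc a) (suc a′) (s≤s z≤n) h≤ (s≤s z≤n) h′≤ same =
  cong suc (Rows.x-suc-injective ℓ m n h≤ h′≤ same)
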